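{- Let $k\ge 2$ and $n\ge 1$. Let $j\in\{1,\dots,k\}$ and $x\in\{1,\dots,k^{n-1}\}$, and let $c$ be an integer with $a(j,x)\le c\le b(j,x)$, where $a(j,x)$ and $b(j,x)$ are the smallest and largest chips that can land at the landing order $(j,x)$. Then there exists a firing strategy that places chip $c$ at $(j,x)$.
   Context: The infinite rooted directed $k$-ary tree: every vertex has $k$ children ordered from leftmost (1st) to rightmost ($k$th). Labeled chip-firing: initially chips labeled $1,\dots,k^n$ are on the root; a vertex holding at least $k$ chips may fire by choosing any $k$ of its chips and sending the chip with the $r$-th smallest label to its $r$-th leftmost child ($r=1,\dots,k$); a firing strategy is any sequence of such choices. Exactly $k^{n-1}$ chips arrive at each child of the root. A strategy places chip $c$ at the landing order $(j,x)$ (on layer 2) if $c$ is the $x$-th smallest of the chips that arrive at the $j$-th leftmost child of the root; a chip can land at $(j,x)$ if some strategy places it there. -}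

module Defs where

open import Data.Nat using (ℕ; zero; suc; _+_; _*_; _∸_; _^_; _≤_; _<_; _<?_)
open import Data.Nat.Properties using (_≟_)
open import Data.Fin as Fin using (Fin)
open import Data.Vec using (Vec; lookup; toList)
open import Data.List using (List; []; _∷_; length; map; filter; upTo)
open import Data.List.Membership.DecPropositional _≟_ using (_∈_; _∈?_)
open import Data.List.Relation.Unary.All using (All)
open import Data.Product using (_×_; Σ; ∃; _,_; proj₁)
open import Relation.Binary.PropositionalEquality using (_≡_)
open import Relation.Nullary using (¬?)

-- A firing of the root in the labeled chip-firing on the k-ary tree:
-- the k chosen chips listed in increasing order; the r-th entry
-- (r : Fin k, 0-indexed) is the r-th smallest chip and is sent to the
-- r-th leftmost child of the root.
Firing : ℕ → Set
Firing k = Vec ℕ k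

StrictlyIncreasing : ∀ {k} → Firing k → Set
StrictlyIncreasing {k} v = (r s : Fin k) → r Fin.< s → lookup v r < lookup v s

removeFired : ∀ {k} → Firing k → List ℕ → List ℕ
removeFired v S = filter (λ c → ¬? (c ∈? toList v)) S

data RootRun (k : ℕ) : List ℕ → List (Firing k) → Set where
  done : ∀ {S} → length S < k → RootRun k S []
  fire : ∀ {S fs} (v : Firing k) →
         StrictlyIncreasing v →
         All (_∈ S) (toList v) →
         RootRun k (removeFired v S) fs →
         RootRun k S (v ∷ fs)

initialChips : ℕ → ℕ → List ℕ
initialChips k n = map suc (upTo (k ^ n))

-- A (complete) firing strategy, as far as the root is concerned:
-- the firings performed at the root. Firings at other vertices do not
-- affect which chips arrive at the children of the root.
Strategy : ℕ → ℕ → Set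
Strategy k n = Σ (List (Firing k)) (RootRun k (initialChips k n))

arrivals : ∀ {k} → List (Firing k) → Fin k → List ℕ
arrivals fs j = map (λ v → lookup v j) fs

-- the strategy places chip c at landing order (j , x): c is the x-th
-- smallest of the chips arriving at child j, i.e. c arrives there and
-- exactly x - 1 arriving chips are smaller than c.
-- (j : Fin k is 0-indexed: Fin.zero is the leftmost child; x is 1-indexed.)
Places : ∀ k n → Strategy k n → ℕ → Fin k → ℕ → Set
Places k n (fs , _) c j x =
  c ∈ arrivals fs j × length (filter (_<? c) (arrivals fs j)) ≡ x ∸ 1

CanLand : ∀ k n → ℕ → Fin k → ℕ → Set
CanLand k n c j x = ∃ λ (σ : Strategy k n) → Places k n σ c j x

IsSmallestLander : ∀ k n → ℕ → Fin k → ℕ → Set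
IsSmallestLander k n a j x = CanLand k n a j x × (∀ c → CanLand k n c j x → a ≤ c)

IsLargestLander : ∀ k n → ℕ → Fin k → ℕ → Set
IsLargestLander k n b j x = CanLand k n b j x × (∀ c → CanLand k n c j x → c ≤ b)

-- A firing sorts its k chips, so a firing that sends a chip ≤ c to child j (0-indexed) also sends
-- j smaller chips to the children on its left, and one that sends a chip ≥ c to child j fires
-- k − j chips ≥ c. The root fires exactly k^(n−1) times and the chips are 1, …, k^n, so counting
-- these chips shows that c can land at (j, x) only if (j + 1) x ≤ c and
-- (k − j)(k^(n−1) − x + 1) ≤ k^n + 1 − c. Both inequalities pass from a and b to every c between
-- them, and they are also sufficient: fire 1, …, j together with c, c + 1, …, and let every further
-- firing take the next ℓ unused chips below c and the next k − ℓ unused chips above c. Child j then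
-- receives a chip below c exactly when ℓ > j, and the two inequalities are what is needed to choose
-- x − 1 values ℓ ∈ [j + 1, k] and k^(n−1) − x values ℓ ∈ [0, j] using up the remaining c − 1 − j
-- chips below c.

{-# OPTIONS --safe #-}
module Submission where

open import Defs
open import Function using (_∘_; _⇔_; mk⇔; Equivalence)
open import Data.Nat using (ℕ; zero; suc; _+_; _*_; _∸_; _^_; _≤_; _<_; _≤?_; _<?_; z≤n; s≤s; s≤s⁻¹; z<s)
open import Data.Nat.Properties
open import Data.Nat.Tactic.RingSolver using (solve-∀)
open import Data.Nat.ListAction using (sum)
open import Data.Nat.ListAction.Properties using (sum-++)
open import Algebra.Properties.CommutativeSemigroup +-commutativeSemigroup using (interchange)
open import Data.Fin as Fin using (Fin; toℕ)
open import Data.Fin.Properties using (toℕ<n; toℕ-injective)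
open import Data.Vec as Vec using (Vec; lookup; toList)
open import Data.Vec.Properties using (length-toList)
import Data.Vec.Relation.Unary.All.Properties as VecAll
open import Data.List using (List; []; _∷_; _++_; length; map; filter; concat; upTo; applyUpTo)
open import Data.List.Properties using (filter-accept; filter-reject; filter-all; filter-none; filter-++; length-++; length-filter; length-map; length-upTo; map-upTo)
open import Data.List.Membership.Propositional using (_∈_; _∉_)
open import Data.List.Membership.Propositional.Properties using (∈-++⁺ˡ; ∈-++⁺ʳ; ∈-++⁻; ∈-filter⁺; ∈-filter⁻)
open import Data.List.Membership.Propositional.Properties.WithK using (unique∧set⇒bag)
open import Data.List.Membership.DecPropositional _≟_ using (_∈?_)
open import Data.List.Relation.Binary.BagAndSetEquality using (∼bag⇒↭)
open import Data.List.Relation.Binary.Disjoint.Propositional using (Disjoint)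
open import Data.List.Relation.Binary.Permutation.Propositional using (_↭_; ↭-refl; ↭-sym; ↭-trans)
open import Data.List.Relation.Binary.Permutation.Propositional.Properties as ↭ using (↭-length; filter-↭; ++⁺ˡ)
open import Data.List.Relation.Unary.All as All using (All; []; _∷_)
import Data.List.Relation.Unary.All.Properties as AllP
open import Data.List.Relation.Unary.Any using (here; there)
open import Data.List.Relation.Unary.AllPairs using ([]; _∷_)
open import Data.List.Relation.Unary.Unique.Propositional using (Unique)
import Data.List.Relation.Unary.Unique.Propositional.Properties as Unique
open import Data.Product using (∃; _×_; _,_; proj₁; proj₂)
open import Data.Sum using (_⊎_; inj₁; inj₂; [_,_]′)
open import Data.Empty using (⊥-elim)
open import Relation.Binary.PropositionalEquality using (_≡_; refl; sym; trans; cong; cong₂; subst; subst₂; module ≡-Reasoning)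
open import Relation.Nullary using (¬_; yes; no; ¬?)
open import Relation.Unary using (Pred; Decidable; ∁)
open import Relation.Unary.Properties using (∁?)

count : ∀ {a p} {A : Set a} {P : Pred A p} → Decidable P → List A → ℕ
count P? = length ∘ filter P?

module _ {a p} {A : Set a} {P : Pred A p} (P? : Decidable P) where

  count-accept : ∀ {x xs} → P x → count P? (x ∷ xs) ≡ suc (count P? xs)
  count-accept Px = cong length (filter-accept P? Px)

  count-reject : ∀ {x xs} → ¬ P x → count P? (x ∷ xs) ≡ count P? xs
  count-reject ¬Px = cong length (filter-reject P? ¬Px)

  count≤length : ∀ xs → count P? xs ≤ length xs
  count≤length = length-filter P?

  count-++ : ∀ xs ys → count P? (xs ++ ys) ≡ count P? xs + count P? ys
  count-++ xs ys = trans (cong length (filter-++ P? xs ys)) (length-++ (filter P? xs))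

  count-↭ : ∀ {xs ys} → xs ↭ ys → count P? xs ≡ count P? ys
  count-↭ = ↭-length ∘ filter-↭ P?

  count≤count-∷ : ∀ x xs → count P? xs ≤ count P? (x ∷ xs)
  count≤count-∷ x xs with P? x
  ... | yes _ = n≤1+n (count P? xs)
  ... | no _ = ≤-refl

  count-all : ∀ {xs} → All P xs → count P? xs ≡ length xs
  count-all = cong length ∘ filter-all P?

  count-none : ∀ {xs} → All (∁ P) xs → count P? xs ≡ 0
  count-none = cong length ∘ filter-none P?


  count+count-∁ : ∀ xs → count P? xs + count (∁? P?) xs ≡ length xs
  count+count-∁ [] = refl
  count+count-∁ (x ∷ xs) with P? x
  ... | yes _ = cong suc (count+count-∁ xs)
  ... | no _ = trans (+-suc _ _) (cong suc (count+count-∁ xs))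

module _ {a p q} {A : Set a} {P : Pred A p} {Q : Pred A q} (P? : Decidable P) (Q? : Decidable Q) where

  count-cong-∷ : ∀ {x y xs ys} → (P x ⇔ Q y) → count P? xs ≡ count Q? ys →
                 count P? (x ∷ xs) ≡ count Q? (y ∷ ys)
  count-cong-∷ {x} {y} Px⇔Qy eq with P? x | Q? y
  ... | yes _  | yes _  = cong suc eq
  ... | yes Px | no ¬Qy = ⊥-elim (¬Qy (Equivalence.to Px⇔Qy Px))
  ... | no ¬Px | yes Qy = ⊥-elim (¬Px (Equivalence.from Px⇔Qy Qy))
  ... | no _   | no _   = eq

  module _ (P⊆Q : ∀ {x} → P x → Q x) where

    count-mono : ∀ xs → count P? xs ≤ count Q? xs
    count-mono [] = z≤n
    count-mono (x ∷ xs) with P? x | Q? x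
    ... | yes _  | yes _  = s≤s (count-mono xs)
    ... | yes Px | no ¬Qx = ⊥-elim (¬Qx (P⊆Q Px))
    ... | no _   | yes _  = m≤n⇒m≤1+n (count-mono xs)
    ... | no _   | no _   = count-mono xs

    count-mono-< : ∀ {x xs} → x ∈ xs → ¬ P x → Q x → count P? xs < count Q? xs
    count-mono-< {x} {.x ∷ xs} (here refl) ¬Px Qx = begin-strict
      count P? (x ∷ xs)   ≡⟨ count-reject P? ¬Px ⟩
      count P? xs         <⟨ s≤s (count-mono xs) ⟩
      suc (count Q? xs)   ≡⟨ count-accept Q? Qx ⟨
      count Q? (x ∷ xs)   ∎
      where open ≤-Reasoning
    count-mono-< {xs = y ∷ ys} (there x∈ys) ¬Px Qx with P? y | Q? y
    ... | yes _  | yes _  = s≤s (count-mono-< x∈ys ¬Px Qx)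
    ... | yes Py | no ¬Qy = ⊥-elim (¬Qy (P⊆Q Py))
    ... | no _   | yes _  = m<n⇒m<1+n (count-mono-< x∈ys ¬Px Qx)
    ... | no _   | no _   = count-mono-< x∈ys ¬Px Qx

↭-++-filter-∉ : ∀ {V S : List ℕ} → Unique V → Unique S → All (_∈ S) V →
                S ↭ V ++ filter (λ c → ¬? (c ∈? V)) S
↭-++-filter-∉ {V} {S} uV uS V⊆S =
  ∼bag⇒↭ (unique∧set⇒bag uS (Unique.++⁺ uV (Unique.filter⁺ ∉V? uS) disjoint) (mk⇔ to from))
  where
  ∉V? = λ c → ¬? (c ∈? V)
  to : ∀ {c} → c ∈ S → c ∈ V ++ filter ∉V? S
  to {c} c∈S with c ∈? V
  ... | yes c∈V = ∈-++⁺ˡ c∈V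
  ... | no c∉V = ∈-++⁺ʳ V (∈-filter⁺ ∉V? c∈S c∉V)
  from : ∀ {c} → c ∈ V ++ filter ∉V? S → c ∈ S
  from c∈ with ∈-++⁻ V c∈
  ... | inj₁ c∈V = All.lookup V⊆S c∈V
  ... | inj₂ c∈F = proj₁ (∈-filter⁻ ∉V? {xs = S} c∈F)
  disjoint : Disjoint V (filter ∉V? S)
  disjoint (c∈V , c∈F) = proj₂ (∈-filter⁻ ∉V? {xs = S} c∈F) c∈V

filter-∉-++ : ∀ (W X Y Z : List ℕ) → All (_∉ W ++ Y) X → All (_∉ W ++ Y) Z →
              filter (λ c → ¬? (c ∈? (W ++ Y))) ((W ++ X) ++ (Y ++ Z)) ≡ X ++ Z
filter-∉-++ W X Y Z X∉ Z∉ = begin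
  filter ∉W++Y? ((W ++ X) ++ (Y ++ Z))
    ≡⟨ filter-++ ∉W++Y? (W ++ X) (Y ++ Z) ⟩
  filter ∉W++Y? (W ++ X) ++ filter ∉W++Y? (Y ++ Z)
    ≡⟨ cong₂ _++_ (filter-++ ∉W++Y? W X) (filter-++ ∉W++Y? Y Z) ⟩
  (filter ∉W++Y? W ++ filter ∉W++Y? X) ++ (filter ∉W++Y? Y ++ filter ∉W++Y? Z)
    ≡⟨ cong₂ _++_ (cong₂ _++_ (filter-none ∉W++Y? W∈) (filter-all ∉W++Y? X∉))
                  (cong₂ _++_ (filter-none ∉W++Y? Y∈) (filter-all ∉W++Y? Z∉)) ⟩
  X ++ Z
    ∎
  where
  open ≡-Reasoning
  ∉W++Y? : Decidable (_∉ W ++ Y)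
  ∉W++Y? c = ¬? (c ∈? (W ++ Y))
  W∈ : All (∁ (_∉ W ++ Y)) W
  W∈ = All.tabulate λ w∈ w∉ → w∉ (∈-++⁺ˡ w∈)
  Y∈ : All (∁ (_∉ W ++ Y)) Y
  Y∈ = All.tabulate λ y∈ y∉ → y∉ (∈-++⁺ʳ W y∈)

all-∈-interleave : ∀ {a} {A : Set a} (W X Y Z : List A) → All (_∈ (W ++ X) ++ (Y ++ Z)) (W ++ Y)
all-∈-interleave W X Y Z = AllP.++⁺ (All.tabulate λ w∈ → ∈-++⁺ˡ (∈-++⁺ˡ w∈))
                                   (All.tabulate λ y∈ → ∈-++⁺ʳ (W ++ X) (∈-++⁺ˡ {ys = Z} y∈))

interval : ℕ → ℕ → List ℕ
interval p zero = []
interval p (suc n) = p ∷ interval (suc p) n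

length-interval : ∀ p n → length (interval p n) ≡ n
length-interval p zero = refl
length-interval p (suc n) = cong suc (length-interval (suc p) n)

interval-++ : ∀ p m n → interval p (m + n) ≡ interval p m ++ interval (p + m) n
interval-++ p zero n = cong (λ q → interval q n) (sym (+-identityʳ p))
interval-++ p (suc m) n = cong (p ∷_) (trans (interval-++ (suc p) m n)
                                             (cong (λ q → interval (suc p) m ++ interval q n) (sym (+-suc p m))))

∈-interval⁻ : ∀ {c} p n → c ∈ interval p n → p ≤ c × c < p + n
∈-interval⁻ p (suc n) (here refl) = ≤-refl , m<m+n p z<s
∈-interval⁻ {c} p (suc n) (there c∈) with ∈-interval⁻ (suc p) n c∈
... | p<c , c<p+1+n = <⇒≤ p<c , subst (c <_) (sym (+-suc p n)) c<p+1+n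

∉-interval : ∀ {c} p n → c < p ⊎ p + n ≤ c → c ∉ interval p n
∉-interval p n outside c∈ with ∈-interval⁻ p n c∈ | outside
... | p≤c , _ | inj₁ c<p = <⇒≱ c<p p≤c
... | _ , c<p+n | inj₂ p+n≤c = <⇒≱ c<p+n p+n≤c

count-<-interval : ∀ t p n → count (_<? t) (interval p n) ≤ t ∸ p
count-<-interval t p zero = z≤n
count-<-interval t p (suc n) with p <? t
... | yes p<t = begin
  count (_<? t) (p ∷ interval (suc p) n)  ≡⟨ count-accept (_<? t) p<t ⟩
  suc (count (_<? t) (interval (suc p) n)) ≤⟨ s≤s (count-<-interval t (suc p) n) ⟩
  suc (t ∸ suc p)                          ≡⟨ +-∸-assoc 1 p<t ⟨
  t ∸ p                                    ∎
  where open ≤-Reasoning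
... | no p≮t = begin
  count (_<? t) (p ∷ interval (suc p) n)   ≡⟨ count-reject (_<? t) p≮t ⟩
  count (_<? t) (interval (suc p) n)       ≤⟨ count-<-interval t (suc p) n ⟩
  t ∸ suc p                                ≤⟨ ∸-monoʳ-≤ t (n≤1+n p) ⟩
  t ∸ p                                    ∎
  where open ≤-Reasoning

count-≮-interval : ∀ t p n → count (∁? (_<? t)) (interval p n) ≤ p + n ∸ t
count-≮-interval t p zero = z≤n
count-≮-interval t p (suc n) with p <? t
... | yes p<t = begin
  count (∁? (_<? t)) (p ∷ interval (suc p) n)  ≡⟨ count-reject (∁? (_<? t)) (λ p≮t → p≮t p<t) ⟩
  count (∁? (_<? t)) (interval (suc p) n)      ≤⟨ count-≮-interval t (suc p) n ⟩
  suc p + n ∸ t                                ≡⟨ cong (_∸ t) (+-suc p n) ⟨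
  p + suc n ∸ t                                ∎
  where open ≤-Reasoning
... | no p≮t = begin
  count (∁? (_<? t)) (p ∷ interval (suc p) n)  ≡⟨ count-accept (∁? (_<? t)) p≮t ⟩
  suc (count (∁? (_<? t)) (interval (suc p) n)) ≤⟨ s≤s (count≤length (∁? (_<? t)) (interval (suc p) n)) ⟩
  suc (length (interval (suc p) n))            ≡⟨ cong suc (length-interval (suc p) n) ⟩
  suc n                                        ≤⟨ m≤n+m (suc n) (p ∸ t) ⟩
  p ∸ t + suc n                                ≡⟨ +-∸-comm (suc n) (≮⇒≥ p≮t) ⟨
  p + suc n ∸ t                                ∎
  where open ≤-Reasoning

strictlyIncreasing⇒unique : ∀ {k} (v : Firing k) → StrictlyIncreasing v → Unique (toList v)
strictlyIncreasing⇒unique Vec.[] _ = []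
strictlyIncreasing⇒unique (c Vec.∷ v) v↑ =
  VecAll.toList⁺ (VecAll.lookup⁻ (λ i → <⇒≢ (v↑ Fin.zero (Fin.suc i) z<s))) ∷
  strictlyIncreasing⇒unique v (λ r s r<s → v↑ (Fin.suc r) (Fin.suc s) (s≤s r<s))

strictlyIncreasing⇒monotone : ∀ {k} (v : Firing k) → StrictlyIncreasing v →
                              ∀ {i j} → toℕ i ≤ toℕ j → lookup v i ≤ lookup v j
strictlyIncreasing⇒monotone v v↑ {i} {j} i≤j with m≤n⇒m<n∨m≡n i≤j
... | inj₁ i<j = <⇒≤ (v↑ i j i<j)
... | inj₂ i≡j = ≤-reflexive (cong (lookup v) (toℕ-injective i≡j))

module _ {a p} {A : Set a} {P : Pred A p} (P? : Decidable P) where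

  count-toList-prefix : ∀ {k} (v : Vec A k) u → u ≤ k → (∀ i → toℕ i < u → P (lookup v i)) →
                        u ≤ count P? (toList v)
  count-toList-prefix v zero _ _ = z≤n
  count-toList-prefix (y Vec.∷ v) (suc u) (s≤s u≤k) Pv = begin
    suc u                      ≤⟨ s≤s (count-toList-prefix v u u≤k (λ i i<u → Pv (Fin.suc i) (s≤s i<u))) ⟩
    suc (count P? (toList v))  ≡⟨ count-accept P? (Pv Fin.zero z<s) ⟨
    count P? (y ∷ toList v)    ∎
    where open ≤-Reasoning

  count-toList-suffix : ∀ {k} (v : Vec A k) u → (∀ i → u ≤ toℕ i → P (lookup v i)) →
                        k ∸ u ≤ count P? (toList v)
  count-toList-suffix {k} v zero Pv = count-toList-prefix v k ≤-refl (λ i _ → Pv i z≤n)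
  count-toList-suffix Vec.[] (suc u) _ = z≤n
  count-toList-suffix (y Vec.∷ v) (suc u) Pv =
    ≤-trans (count-toList-suffix v u (λ i u≤i → Pv (Fin.suc i) (s≤s u≤i))) (count≤count-∷ P? y (toList v))

count-<-firing : ∀ {k t} {v : Firing k} (j : Fin k) → StrictlyIncreasing v → lookup v j < t →
                 suc (toℕ j) ≤ count (_<? t) (toList v)
count-<-firing {t = t} {v} j v↑ vⱼ<t = count-toList-prefix (_<? t) v (suc (toℕ j)) (toℕ<n j)
  (λ i i≤j → ≤-<-trans (strictlyIncreasing⇒monotone v v↑ (s≤s⁻¹ i≤j)) vⱼ<t)

count-≮-firing : ∀ {k t} {v : Firing k} (j : Fin k) → StrictlyIncreasing v → ¬ lookup v j < t →
                 k ∸ toℕ j ≤ count (∁? (_<? t)) (toList v)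
count-≮-firing {t = t} {v} j v↑ vⱼ≮t = count-toList-suffix (∁? (_<? t)) v (toℕ j)
  (λ i j≤i → ≤⇒≯ (≤-trans (≮⇒≥ vⱼ≮t) (strictlyIncreasing⇒monotone v v↑ j≤i)))

fired : ∀ {k} → List (Firing k) → List ℕ
fired = concat ∘ map toList

length-fired : ∀ {k} (fs : List (Firing k)) → length (fired fs) ≡ k * length fs
length-fired {k} [] = sym (*-zeroʳ k)
length-fired {k} (v ∷ fs) = begin
  length (toList v ++ fired fs)          ≡⟨ length-++ (toList v) ⟩
  length (toList v) + length (fired fs)  ≡⟨ cong₂ _+_ (length-toList v) (length-fired fs) ⟩
  k + k * length fs                      ≡⟨ *-suc k (length fs) ⟨
  k * suc (length fs)                    ∎
  where open ≡-Reasoning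

count-arrivals : ∀ {k p} {P : Pred ℕ p} (P? : Decidable P) (j : Fin k) m fs →
                 All (λ v → P (lookup v j) → m ≤ count P? (toList v)) fs →
                 m * count P? (arrivals fs j) ≤ count P? (fired fs)
count-arrivals P? j m [] [] = ≤-reflexive (*-zeroʳ m)
count-arrivals P? j m (v ∷ fs) (bound ∷ bounds) with P? (lookup v j)
... | yes Pvⱼ = begin
  m * suc (count P? (arrivals fs j))         ≡⟨ *-suc m _ ⟩
  m + m * count P? (arrivals fs j)           ≤⟨ +-mono-≤ (bound Pvⱼ) (count-arrivals P? j m fs bounds) ⟩
  count P? (toList v) + count P? (fired fs)  ≡⟨ count-++ P? (toList v) (fired fs) ⟨
  count P? (fired (v ∷ fs))                  ∎
  where open ≤-Reasoning
... | no _ = begin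
  m * count P? (arrivals fs j)               ≤⟨ count-arrivals P? j m fs bounds ⟩
  count P? (fired fs)                        ≤⟨ m≤n+m _ _ ⟩
  count P? (toList v) + count P? (fired fs)  ≡⟨ count-++ P? (toList v) (fired fs) ⟨
  count P? (fired (v ∷ fs))                  ∎
  where open ≤-Reasoning

run-↭ : ∀ {k S fs} → RootRun k S fs → Unique S → ∃ λ R → length R < k × S ↭ fired fs ++ R
run-↭ {S = S} (done |S|<k) _ = S , |S|<k , ↭-refl
run-↭ {fs = v ∷ fs} (fire v v↑ v⊆S run) uS with run-↭ run (Unique.filter⁺ _ uS)
... | R , |R|<k , rest↭ = R , |R|<k , ↭-trans (↭-++-filter-∉ (strictlyIncreasing⇒unique v v↑) uS v⊆S)
                                        (↭-trans (++⁺ˡ (toList v) rest↭) (↭-sym (↭.++-assoc (toList v) (fired fs) R)))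

count-fired≤count : ∀ {k S fs p} {P : Pred ℕ p} → RootRun k S fs → Unique S → (P? : Decidable P) →
                    count P? (fired fs) ≤ count P? S
count-fired≤count {S = S} {fs} run uS P? with run-↭ run uS
... | R , _ , S↭ = begin
  count P? (fired fs)               ≤⟨ m≤m+n _ _ ⟩
  count P? (fired fs) + count P? R  ≡⟨ count-++ P? (fired fs) R ⟨
  count P? (fired fs ++ R)          ≡⟨ count-↭ P? S↭ ⟨
  count P? S                        ∎
  where open ≤-Reasoning

run-length : ∀ {k S fs} → RootRun k S fs → Unique S → ∃ λ r → r < k × length S ≡ k * length fs + r
run-length {fs = fs} run uS with run-↭ run uS
... | R , |R|<k , S↭ = length R , |R|<k ,
  trans (↭-length S↭) (trans (length-++ (fired fs)) (cong (_+ length R) (length-fired fs)))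

run-strictlyIncreasing : ∀ {k S fs} → RootRun k S fs → All StrictlyIncreasing fs
run-strictlyIncreasing (done _) = []
run-strictlyIncreasing (fire _ v↑ _ run) = v↑ ∷ run-strictlyIncreasing run

length-initialChips : ∀ k n → length (initialChips k n) ≡ k ^ n
length-initialChips k n = trans (length-map suc (upTo (k ^ n))) (length-upTo (k ^ n))

unique-initialChips : ∀ k n → Unique (initialChips k n)
unique-initialChips k n = Unique.map⁺ suc-injective (Unique.upTo⁺ (k ^ n))

applyUpTo-interval : ∀ (f : ℕ → ℕ) p n → (∀ i → f i ≡ p + i) → applyUpTo f n ≡ interval p n
applyUpTo-interval f p zero _ = refl
applyUpTo-interval f p (suc n) f≗ =
  cong₂ _∷_ (trans (f≗ 0) (+-identityʳ p))
            (applyUpTo-interval (f ∘ suc) (suc p) n (λ i → trans (f≗ (suc i)) (+-suc p i)))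

initialChips≡interval : ∀ k n → initialChips k n ≡ interval 1 (k ^ n)
initialChips≡interval k n =
  trans (map-upTo suc (k ^ n)) (applyUpTo-interval suc 1 (k ^ n) (λ _ → refl))

kⁿ≤length-initialRun : ∀ {k} n {fs} → RootRun k (initialChips k (suc n)) fs → k ^ n ≤ length fs
kⁿ≤length-initialRun {k} n {fs} run with run-length run (unique-initialChips k (suc n))
... | r , r<k , len≡ = s≤s⁻¹ (*-cancelˡ-< k (k ^ n) (suc (length fs)) (begin-strict
  k * k ^ n                          ≡⟨ length-initialChips k (suc n) ⟨
  length (initialChips k (suc n))    ≡⟨ len≡ ⟩
  k * length fs + r                  <⟨ +-monoʳ-< (k * length fs) r<k ⟩
  k * length fs + k                  ≡⟨ +-comm (k * length fs) k ⟩
  k + k * length fs                  ≡⟨ *-suc k (length fs) ⟨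
  k * suc (length fs)                ∎))
  where open ≤-Reasoning

-- Necessary conditions for landing

-- Here n is one less than in the theorem: the root fires k ^ n times and the chips are 1, …, k ^ suc n.
record LandingBounds (k n c : ℕ) (j : Fin k) (x : ℕ) : Set where
  field
    lower : suc (toℕ j) * x ≤ c
    upper : (k ∸ toℕ j) * (k ^ n ∸ (x ∸ 1)) ≤ suc (k ^ suc n) ∸ c

canLand⇒lowerBound : ∀ {k} n {c j x} → 1 ≤ x → CanLand k (suc n) c j x → suc (toℕ j) * x ≤ c
canLand⇒lowerBound {k} n {c} {j} {x} 1≤x ((fs , run) , c∈ , #<c≡) = begin
  suc J * x                                   ≤⟨ *-monoʳ-≤ (suc J) x≤#≤c ⟩
  suc J * count (_<? suc c) (arrivals fs j)   ≤⟨ count-arrivals (_<? suc c) j (suc J) fs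
                                                   (All.map (λ {v} → count-<-firing {v = v} j) (run-strictlyIncreasing run)) ⟩
  count (_<? suc c) (fired fs)                ≤⟨ count-fired≤count run (unique-initialChips k (suc n)) (_<? suc c) ⟩
  count (_<? suc c) (initialChips k (suc n))  ≡⟨ cong (count (_<? suc c)) (initialChips≡interval k (suc n)) ⟩
  count (_<? suc c) (interval 1 (k ^ suc n))  ≤⟨ count-<-interval (suc c) 1 (k ^ suc n) ⟩
  c                                           ∎
  where
  open ≤-Reasoning
  J = toℕ j
  x≤#≤c : x ≤ count (_<? suc c) (arrivals fs j)
  x≤#≤c = begin
    x                                   ≡⟨ m+[n∸m]≡n 1≤x ⟨
    suc (x ∸ 1)                         ≡⟨ cong suc #<c≡ ⟨
    suc (count (_<? c) (arrivals fs j)) ≤⟨ count-mono-< (_<? c) (_<? suc c) m<n⇒m<1+n c∈ (n≮n c) ≤-refl ⟩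
    count (_<? suc c) (arrivals fs j)   ∎

canLand⇒upperBound : ∀ {k} n {c j x} → CanLand k (suc n) c j x →
                     (k ∸ toℕ j) * (k ^ n ∸ (x ∸ 1)) ≤ suc (k ^ suc n) ∸ c
canLand⇒upperBound {k} n {c} {j} {x} ((fs , run) , _ , #<c≡) = begin
  (k ∸ J) * (k ^ n ∸ (x ∸ 1))                     ≤⟨ *-monoʳ-≤ (k ∸ J) (∸-monoˡ-≤ (x ∸ 1) (kⁿ≤length-initialRun n run)) ⟩
  (k ∸ J) * (length fs ∸ (x ∸ 1))                 ≡⟨ cong ((k ∸ J) *_) #≮c≡ ⟨
  (k ∸ J) * count (∁? (_<? c)) arr                ≤⟨ count-arrivals (∁? (_<? c)) j (k ∸ J) fs
                                                       (All.map (λ {v} → count-≮-firing {v = v} j) (run-strictlyIncreasing run)) ⟩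
  count (∁? (_<? c)) (fired fs)                   ≤⟨ count-fired≤count run (unique-initialChips k (suc n)) (∁? (_<? c)) ⟩
  count (∁? (_<? c)) (initialChips k (suc n))     ≡⟨ cong (count (∁? (_<? c))) (initialChips≡interval k (suc n)) ⟩
  count (∁? (_<? c)) (interval 1 (k ^ suc n))     ≤⟨ count-≮-interval c 1 (k ^ suc n) ⟩
  suc (k ^ suc n) ∸ c                             ∎
  where
  open ≤-Reasoning
  J = toℕ j
  arr = arrivals fs j
  #≮c≡ : count (∁? (_<? c)) arr ≡ length fs ∸ (x ∸ 1)
  #≮c≡ = begin-equality
    count (∁? (_<? c)) arr                                          ≡⟨ m+n∸m≡n (count (_<? c) arr) _ ⟨
    count (_<? c) arr + count (∁? (_<? c)) arr ∸ count (_<? c) arr  ≡⟨ cong₂ _∸_ (count+count-∁ (_<? c) arr) #<c≡ ⟩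
    length arr ∸ (x ∸ 1)                                            ≡⟨ cong (_∸ (x ∸ 1)) (length-map _ fs) ⟩
    length fs ∸ (x ∸ 1)                                             ∎

canLand⇒landingBounds : ∀ {k} n {c j x} → 1 ≤ x → CanLand k (suc n) c j x → LandingBounds k n c j x
canLand⇒landingBounds n {x = x} 1≤x lands = record
  { lower = canLand⇒lowerBound n 1≤x lands
  ; upper = canLand⇒upperBound n {x = x} lands
  }

landingBounds-between : ∀ {k n a b c j x} → a ≤ c → c ≤ b →
                        LandingBounds k n a j x → LandingBounds k n b j x → LandingBounds k n c j x
landingBounds-between {k} {n} a≤c c≤b boundsₐ boundsᵦ = record
  { lower = ≤-trans (LandingBounds.lower boundsₐ) a≤c
  ; upper = ≤-trans (LandingBounds.upper boundsᵦ) (∸-monoʳ-≤ (suc (k ^ suc n)) c≤b)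
  }

-- Firings of consecutive low and high chips

lowHighFiring : ∀ k → ℕ → ℕ → ℕ → Firing k
lowHighFiring zero    ℓ       p r = Vec.[]
lowHighFiring (suc k) zero    p r = r Vec.∷ lowHighFiring k zero p (suc r)
lowHighFiring (suc k) (suc ℓ) p r = p Vec.∷ lowHighFiring k ℓ (suc p) r

toList-lowHighFiring : ∀ k ℓ p r → ℓ ≤ k →
                       toList (lowHighFiring k ℓ p r) ≡ interval p ℓ ++ interval r (k ∸ ℓ)
toList-lowHighFiring zero    zero    p r _         = refl
toList-lowHighFiring (suc k) zero    p r _         = cong (r ∷_) (toList-lowHighFiring k zero p (suc r) z≤n)
toList-lowHighFiring (suc k) (suc ℓ) p r (s≤s ℓ≤k) = cong (p ∷_) (toList-lowHighFiring k ℓ (suc p) r ℓ≤k)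

lookup-lowHighFiring-low : ∀ k ℓ p r (i : Fin k) → toℕ i < ℓ → lookup (lowHighFiring k ℓ p r) i ≡ p + toℕ i
lookup-lowHighFiring-low (suc k) (suc ℓ) p r Fin.zero    _         = sym (+-identityʳ p)
lookup-lowHighFiring-low (suc k) (suc ℓ) p r (Fin.suc i) (s≤s i<ℓ) =
  trans (lookup-lowHighFiring-low k ℓ (suc p) r i i<ℓ) (sym (+-suc p (toℕ i)))

lookup-lowHighFiring-high : ∀ k ℓ p r (i : Fin k) → ℓ ≤ toℕ i →
                            lookup (lowHighFiring k ℓ p r) i ≡ r + (toℕ i ∸ ℓ)
lookup-lowHighFiring-high (suc k) zero    p r Fin.zero    _         = sym (+-identityʳ r)
lookup-lowHighFiring-high (suc k) zero    p r (Fin.suc i) _         =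
  trans (lookup-lowHighFiring-high k zero p (suc r) i z≤n) (sym (+-suc r (toℕ i)))
lookup-lowHighFiring-high (suc k) (suc ℓ) p r (Fin.suc i) (s≤s ℓ≤i) = lookup-lowHighFiring-high k ℓ (suc p) r i ℓ≤i

lowHighFiring-strictlyIncreasing : ∀ k ℓ p r → p + ℓ ≤ r → StrictlyIncreasing (lowHighFiring k ℓ p r)
lowHighFiring-strictlyIncreasing k ℓ p r p+ℓ≤r i i′ i<i′ with toℕ i <? ℓ | toℕ i′ <? ℓ
... | yes i<ℓ | yes i′<ℓ = begin-strict
  lookup (lowHighFiring k ℓ p r) i   ≡⟨ lookup-lowHighFiring-low k ℓ p r i i<ℓ ⟩
  p + toℕ i                          <⟨ +-monoʳ-< p i<i′ ⟩
  p + toℕ i′                         ≡⟨ lookup-lowHighFiring-low k ℓ p r i′ i′<ℓ ⟨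
  lookup (lowHighFiring k ℓ p r) i′  ∎
  where open ≤-Reasoning
... | yes i<ℓ | no i′≮ℓ = begin-strict
  lookup (lowHighFiring k ℓ p r) i   ≡⟨ lookup-lowHighFiring-low k ℓ p r i i<ℓ ⟩
  p + toℕ i                          <⟨ +-monoʳ-< p i<ℓ ⟩
  p + ℓ                              ≤⟨ p+ℓ≤r ⟩
  r                                  ≤⟨ m≤m+n r _ ⟩
  r + (toℕ i′ ∸ ℓ)                   ≡⟨ lookup-lowHighFiring-high k ℓ p r i′ (≮⇒≥ i′≮ℓ) ⟨
  lookup (lowHighFiring k ℓ p r) i′  ∎
  where open ≤-Reasoning
... | no i≮ℓ | yes i′<ℓ = ⊥-elim (i≮ℓ (<-trans i<i′ i′<ℓ))
... | no i≮ℓ | no i′≮ℓ = begin-strict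
  lookup (lowHighFiring k ℓ p r) i   ≡⟨ lookup-lowHighFiring-high k ℓ p r i (≮⇒≥ i≮ℓ) ⟩
  r + (toℕ i ∸ ℓ)                    <⟨ +-monoʳ-< r (∸-monoˡ-< i<i′ (≮⇒≥ i≮ℓ)) ⟩
  r + (toℕ i′ ∸ ℓ)                   ≡⟨ lookup-lowHighFiring-high k ℓ p r i′ (≮⇒≥ i′≮ℓ) ⟨
  lookup (lowHighFiring k ℓ p r) i′  ∎
  where open ≤-Reasoning

lowHighFiring-arrival-< : ∀ k ℓ p r c (j : Fin k) → p + ℓ ≤ c → c ≤ r →
                          lookup (lowHighFiring k ℓ p r) j < c ⇔ toℕ j < ℓ
lowHighFiring-arrival-< k ℓ p r c j p+ℓ≤c c≤r = mk⇔ to from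
  where
  open ≤-Reasoning
  to : lookup (lowHighFiring k ℓ p r) j < c → toℕ j < ℓ
  to arrival<c with toℕ j <? ℓ
  ... | yes j<ℓ = j<ℓ
  ... | no j≮ℓ = ⊥-elim (<⇒≱ arrival<c (begin
    c                                 ≤⟨ c≤r ⟩
    r                                 ≤⟨ m≤m+n r _ ⟩
    r + (toℕ j ∸ ℓ)                   ≡⟨ lookup-lowHighFiring-high k ℓ p r j (≮⇒≥ j≮ℓ) ⟨
    lookup (lowHighFiring k ℓ p r) j  ∎))
  from : toℕ j < ℓ → lookup (lowHighFiring k ℓ p r) j < c
  from j<ℓ = begin-strict
    lookup (lowHighFiring k ℓ p r) j  ≡⟨ lookup-lowHighFiring-low k ℓ p r j j<ℓ ⟩
    p + toℕ j                         <⟨ +-monoʳ-< p j<ℓ ⟩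
    p + ℓ                             ≤⟨ p+ℓ≤c ⟩
    c                                 ∎

-- p and r are the next unused low and high chips.
lowHighFirings : ∀ k → ℕ → ℕ → List ℕ → List (Firing k)
lowHighFirings k p r [] = []
lowHighFirings k p r (ℓ ∷ ls) = lowHighFiring k ℓ p r ∷ lowHighFirings k (p + ℓ) (r + (k ∸ ℓ)) ls

removeFired-lowHighFiring : ∀ k ℓ p r L H → ℓ ≤ k → p + ℓ + L ≤ r →
  removeFired (lowHighFiring k ℓ p r)
    ((interval p ℓ ++ interval (p + ℓ) L) ++ (interval r (k ∸ ℓ) ++ interval (r + (k ∸ ℓ)) H))
  ≡ interval (p + ℓ) L ++ interval (r + (k ∸ ℓ)) H
removeFired-lowHighFiring k ℓ p r L H ℓ≤k p+ℓ+L≤r =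
  trans (cong (λ V → filter (λ c → ¬? (c ∈? V)) ((low ++ lowRest) ++ (high ++ highRest)))
              (toList-lowHighFiring k ℓ p r ℓ≤k))
        (filter-∉-++ low lowRest high highRest lowRest∉ highRest∉)
  where
  h = k ∸ ℓ
  low = interval p ℓ
  high = interval r h
  lowRest = interval (p + ℓ) L
  highRest = interval (r + h) H
  ∉low++high : ∀ {c} → c ∉ low → c ∉ high → c ∉ low ++ high
  ∉low++high c∉low c∉high c∈ = [ c∉low , c∉high ]′ (∈-++⁻ low c∈)
  lowRest∉ : All (_∉ low ++ high) lowRest
  lowRest∉ = All.tabulate λ {c} c∈ → let (p+ℓ≤c , c<p+ℓ+L) = ∈-interval⁻ (p + ℓ) L c∈ in
    ∉low++high (∉-interval p ℓ (inj₂ p+ℓ≤c)) (∉-interval r h (inj₁ (<-≤-trans c<p+ℓ+L p+ℓ+L≤r)))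
  highRest∉ : All (_∉ low ++ high) highRest
  highRest∉ = All.tabulate λ {c} c∈ → let r+h≤c = proj₁ (∈-interval⁻ (r + h) H c∈) in
    ∉low++high (∉-interval p ℓ (inj₂ (≤-trans (m≤m+n (p + ℓ) L) (≤-trans p+ℓ+L≤r (≤-trans (m≤m+n r h) r+h≤c)))))
               (∉-interval r h (inj₂ r+h≤c))

lowHighFirings-run : ∀ k → 0 < k → ∀ ls p r → All (_≤ k) ls → p + sum ls ≤ r →
  RootRun k (interval p (sum ls) ++ interval r (sum (map (k ∸_) ls))) (lowHighFirings k p r ls)
lowHighFirings-run k 0<k [] p r [] _ = done 0<k
lowHighFirings-run k 0<k (ℓ ∷ ls) p r (ℓ≤k ∷ ls≤k) p+[ℓ+L]≤r =
  subst (λ S → RootRun k S (lowHighFirings k p r (ℓ ∷ ls))) (sym chips≡)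
    (fire v (lowHighFiring-strictlyIncreasing k ℓ p r (≤-trans (m≤m+n (p + ℓ) L) p+ℓ+L≤r)) v⊆chips
      (subst (λ S → RootRun k S (lowHighFirings k (p + ℓ) (r + h) ls))
             (sym (removeFired-lowHighFiring k ℓ p r L H ℓ≤k p+ℓ+L≤r))
             (lowHighFirings-run k 0<k ls (p + ℓ) (r + h) ls≤k (≤-trans p+ℓ+L≤r (m≤m+n r h)))))
  where
  h = k ∸ ℓ
  L = sum ls
  H = sum (map (k ∸_) ls)
  v = lowHighFiring k ℓ p r
  chips = (interval p ℓ ++ interval (p + ℓ) L) ++ (interval r h ++ interval (r + h) H)
  p+ℓ+L≤r : p + ℓ + L ≤ r
  p+ℓ+L≤r = ≤-trans (≤-reflexive (+-assoc p ℓ L)) p+[ℓ+L]≤r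
  chips≡ : interval p (ℓ + L) ++ interval r (h + H) ≡ chips
  chips≡ = cong₂ _++_ (interval-++ p ℓ L) (interval-++ r h H)
  v⊆chips : All (_∈ chips) (toList v)
  v⊆chips = subst (All (_∈ chips)) (sym (toList-lowHighFiring k ℓ p r ℓ≤k))
                  (all-∈-interleave (interval p ℓ) (interval (p + ℓ) L) (interval r h) (interval (r + h) H))

lowHighFirings-count : ∀ k (j : Fin k) c ls p r → p + sum ls ≤ c → c ≤ r →
                       count (_<? c) (arrivals (lowHighFirings k p r ls) j) ≡ count (toℕ j <?_) ls
lowHighFirings-count k j c [] p r _ _ = refl
lowHighFirings-count k j c (ℓ ∷ ls) p r p+ℓ+L≤c c≤r =
  count-cong-∷ (_<? c) (toℕ j <?_)
    (lowHighFiring-arrival-< k ℓ p r c j (≤-trans (m≤m+n (p + ℓ) (sum ls)) p+ℓ+L≤c′) c≤r)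
    (lowHighFirings-count k j c ls (p + ℓ) (r + (k ∸ ℓ)) p+ℓ+L≤c′ (≤-trans c≤r (m≤m+n r (k ∸ ℓ))))
  where
  p+ℓ+L≤c′ : p + ℓ + sum ls ≤ c
  p+ℓ+L≤c′ = ≤-trans (≤-reflexive (+-assoc p ℓ (sum ls))) p+ℓ+L≤c

sum+sum-∸ : ∀ k ls → All (_≤ k) ls → sum ls + sum (map (k ∸_) ls) ≡ k * length ls
sum+sum-∸ k [] [] = sym (*-zeroʳ k)
sum+sum-∸ k (ℓ ∷ ls) (ℓ≤k ∷ ls≤k) = begin
  (ℓ + sum ls) + (k ∸ ℓ + sum (map (k ∸_) ls))    ≡⟨ interchange ℓ (sum ls) (k ∸ ℓ) _ ⟩
  (ℓ + (k ∸ ℓ)) + (sum ls + sum (map (k ∸_) ls))  ≡⟨ cong₂ _+_ (m+[n∸m]≡n ℓ≤k) (sum+sum-∸ k ls ls≤k) ⟩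
  k + k * length ls                               ≡⟨ *-suc k (length ls) ⟨
  k * suc (length ls)                             ∎
  where open ≡-Reasoning

lowHighFirings-canLand : ∀ k n (j : Fin k) ls → All (_≤ k) ls → k ^ n ≡ k * suc (length ls) →
                         CanLand k n (suc (toℕ j + sum ls)) j (suc (count (toℕ j <?_) ls))
lowHighFirings-canLand k n j ls ls≤k kⁿ≡ = (fs , run) , here (sym first-arrival) , #below-c
  where
  J = toℕ j
  c = suc (J + sum ls)
  H = sum (map (k ∸_) ls)
  fs = lowHighFirings k 1 c (J ∷ ls)
  J≤k : J ≤ k
  J≤k = <⇒≤ (toℕ<n j)
  kⁿ-split : k ^ n ≡ (J + sum ls) + (k ∸ J + H)
  kⁿ-split = begin
    k ^ n                          ≡⟨ kⁿ≡ ⟩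
    k * suc (length ls)            ≡⟨ *-suc k (length ls) ⟩
    k + k * length ls              ≡⟨ cong₂ _+_ (m+[n∸m]≡n J≤k) (sum+sum-∸ k ls ls≤k) ⟨
    (J + (k ∸ J)) + (sum ls + H)   ≡⟨ interchange J (k ∸ J) (sum ls) H ⟩
    (J + sum ls) + (k ∸ J + H)     ∎
    where open ≡-Reasoning
  chips≡ : initialChips k n ≡ interval 1 (J + sum ls) ++ interval c (k ∸ J + H)
  chips≡ = trans (initialChips≡interval k n)
                 (trans (cong (interval 1) kⁿ-split) (interval-++ 1 (J + sum ls) (k ∸ J + H)))
  run : RootRun k (initialChips k n) fs
  run = subst (λ S → RootRun k S fs) (sym chips≡)
              (lowHighFirings-run k (≤-<-trans z≤n (toℕ<n j)) (J ∷ ls) 1 c (J≤k ∷ ls≤k) ≤-refl)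
  first-arrival : lookup (lowHighFiring k J 1 c) j ≡ c
  first-arrival = trans (lookup-lowHighFiring-high k J 1 c j ≤-refl)
                        (trans (cong (c +_) (n∸n≡0 J)) (+-identityʳ c))
  #below-c : count (_<? c) (arrivals fs j) ≡ count (J <?_) ls
  #below-c = trans (count-reject (_<? c) (λ c<c → n≮n c (subst (_< c) first-arrival c<c)))
                   (lowHighFirings-count k j c ls (1 + J) (c + (k ∸ J)) ≤-refl (m≤m+n c (k ∸ J)))

-- Choosing the numbers of low chips

boundedComposition : ∀ n {lo hi} s → lo ≤ hi → n * lo ≤ s → s ≤ n * hi →
                     ∃ λ ls → length ls ≡ n × All (λ ℓ → lo ≤ ℓ × ℓ ≤ hi) ls × sum ls ≡ s
boundedComposition zero s _ _ s≤0 = [] , refl , [] , sym (n≤0⇒n≡0 s≤0)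
boundedComposition (suc n) {lo} {hi} s lo≤hi lo+n*lo≤s s≤hi+n*hi with s ≤? lo + n * hi
... | yes s≤lo+n*hi
  with boundedComposition n (s ∸ lo) lo≤hi
         (m+n≤o⇒m≤o∸n (n * lo) (subst (_≤ s) (+-comm lo (n * lo)) lo+n*lo≤s)) (m≤n+o⇒m∸n≤o s lo s≤lo+n*hi)
...   | ls , len , bounded , sum≡ =
  lo ∷ ls , cong suc len , (≤-refl , lo≤hi) ∷ bounded ,
  trans (cong (lo +_) sum≡) (m+[n∸m]≡n (≤-trans (m≤m+n lo (n * lo)) lo+n*lo≤s))
boundedComposition (suc n) {lo} {hi} s lo≤hi _ s≤hi+n*hi | no s≰lo+n*hi
  with boundedComposition n (n * hi) lo≤hi (*-monoʳ-≤ n lo≤hi) ≤-refl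
... | ls , len , bounded , sum≡ =
  s ∸ n * hi ∷ ls , cong suc len ,
  (m+n≤o⇒m≤o∸n lo (<⇒≤ (≰⇒> s≰lo+n*hi)) ,
   m≤n+o⇒m∸n≤o s (n * hi) (subst (s ≤_) (+-comm hi (n * hi)) s≤hi+n*hi)) ∷ bounded ,
  trans (cong (s ∸ n * hi +_) sum≡) (m∸n+n≡m (≤-trans (m≤n+m (n * hi) lo) (<⇒≤ (≰⇒> s≰lo+n*hi))))

split-≤-+ : ∀ {a b d s} → a ≤ b → a ≤ s → s ≤ b + d →
            ∃ λ s₁ → ∃ λ s₂ → s₁ + s₂ ≡ s × a ≤ s₁ × s₁ ≤ b × s₂ ≤ d
split-≤-+ {a} {b} {d} {s} a≤b a≤s s≤b+d with s ≤? b
... | yes s≤b = s , 0 , +-identityʳ s , a≤s , s≤b , z≤n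
... | no s≰b = b , s ∸ b , m+[n∸m]≡n (<⇒≤ (≰⇒> s≰b)) , a≤b , ≤-refl , m≤n+o⇒m∸n≤o s b s≤b+d

lowChipCounts : ∀ k J B A s → J < k → B * suc J ≤ s → s ≤ B * k + A * J →
                ∃ λ ls → All (_≤ k) ls × length ls ≡ B + A × sum ls ≡ s × count (J <?_) ls ≡ B
lowChipCounts k J B A s J<k lower upper with split-≤-+ (*-monoʳ-≤ B J<k) lower upper
... | s₁ , s₂ , s₁+s₂≡s , lower₁ , upper₁ , upper₂
  with boundedComposition B s₁ J<k lower₁ upper₁
     | boundedComposition A s₂ z≤n (≤-trans (≤-reflexive (*-zeroʳ A)) z≤n) upper₂
... | lsB , lenB , boundedB , sumB | lsA , lenA , boundedA , sumA =
  lsB ++ lsA ,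
  AllP.++⁺ (All.map proj₂ boundedB) (All.map (λ bounds → ≤-trans (proj₂ bounds) (<⇒≤ J<k)) boundedA) ,
  trans (length-++ lsB) (cong₂ _+_ lenB lenA) ,
  trans (sum-++ lsB lsA) (trans (cong₂ _+_ sumB sumA) s₁+s₂≡s) ,
  trans (count-++ (J <?_) lsB lsA)
        (trans (cong₂ _+_ (trans (count-all (J <?_) (All.map proj₁ boundedB)) lenB)
                          (count-none (J <?_) (All.map (λ bounds → ≤⇒≯ (proj₂ bounds)) boundedA)))
               (+-identityʳ B))

landingBounds⇒lowChipBounds : ∀ {k n c B A} (j : Fin k) → k ^ n ≡ B + suc A → LandingBounds k n c j (suc B) →
  ∃ λ s → c ≡ suc (toℕ j + s) × B * suc (toℕ j) ≤ s × s ≤ B * k + A * toℕ j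
landingBounds⇒lowChipBounds {k} {n} {suc c} {B} {A} j kⁿ≡ record { lower = s≤s lower ; upper = upper } =
  c ∸ J , cong suc (sym (m+[n∸m]≡n J≤c)) , s-lower , subst (λ k′ → c ∸ J ≤ B * k′ + A * J) J+K≡k s-upper
  where
  open ≤-Reasoning
  J = toℕ j
  K = k ∸ J
  J+K≡k : J + K ≡ k
  J+K≡k = m+[n∸m]≡n (<⇒≤ (toℕ<n j))
  reorder : ∀ J B → B + J * suc B ≡ J + B * suc J
  reorder = solve-∀
  expand : ∀ J K A B → (J + K) * (B + suc A) ≡ K * suc A + J + (B * (J + K) + A * J)
  expand = solve-∀
  J+B*sucJ≤c : J + B * suc J ≤ c
  J+B*sucJ≤c = subst (_≤ c) (reorder J B) lower
  J≤c : J ≤ c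
  J≤c = ≤-trans (m≤m+n J (B * suc J)) J+B*sucJ≤c
  s-lower : B * suc J ≤ c ∸ J
  s-lower = m+n≤o⇒m≤o∸n (B * suc J) (subst (_≤ c) (+-comm J (B * suc J)) J+B*sucJ≤c)
  K*sucA≤ : K * suc A ≤ k * k ^ n ∸ c
  K*sucA≤ = subst (λ m → K * m ≤ k * k ^ n ∸ c) (trans (cong (_∸ B) kⁿ≡) (m+n∸m≡n B (suc A))) upper
  c≤kⁿ⁺¹ : c ≤ k * k ^ n
  c≤kⁿ⁺¹ = <⇒≤ (m∸n≢0⇒n<m (m<n⇒n≢0 (≤-trans (*-monoˡ-≤ (suc A) (m<n⇒0<n∸m (toℕ<n j))) K*sucA≤)))
  s-upper : c ∸ J ≤ B * (J + K) + A * J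
  s-upper = +-cancelˡ-≤ (K * suc A + J) (c ∸ J) (B * (J + K) + A * J) (begin
    K * suc A + J + (c ∸ J)               ≡⟨ +-assoc (K * suc A) J (c ∸ J) ⟩
    K * suc A + (J + (c ∸ J))             ≡⟨ cong (K * suc A +_) (m+[n∸m]≡n J≤c) ⟩
    K * suc A + c                         ≤⟨ m≤o∸n⇒m+n≤o (K * suc A) c≤kⁿ⁺¹ K*sucA≤ ⟩
    k * k ^ n                             ≡⟨ cong₂ _*_ (sym J+K≡k) kⁿ≡ ⟩
    (J + K) * (B + suc A)                 ≡⟨ expand J K A B ⟩
    K * suc A + J + (B * (J + K) + A * J) ∎)

landingBounds⇒canLand : ∀ {k} n {c B} (j : Fin k) → suc B ≤ k ^ n →
                        LandingBounds k n c j (suc B) → CanLand k (suc n) c j (suc B)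
landingBounds⇒canLand {k} n {c} {B} j sucB≤kⁿ bounds =
  let s , c≡ , s-lower , s-upper = landingBounds⇒lowChipBounds j kⁿ≡ bounds
      ls , ls≤k , len , sum≡ , count≡ = lowChipCounts k (toℕ j) B A s (toℕ<n j) s-lower s-upper
  in subst₂ (λ c′ x → CanLand k (suc n) c′ j x)
            (sym (trans c≡ (cong (λ s′ → suc (toℕ j + s′)) (sym sum≡)))) (cong suc count≡)
            (lowHighFirings-canLand k (suc n) j ls ls≤k
              (cong (k *_) (trans kⁿ≡ (trans (+-suc B A) (cong suc (sym len))))))
  where
  A = k ^ n ∸ suc B
  kⁿ≡ : k ^ n ≡ B + suc A
  kⁿ≡ = sym (trans (+-suc B A) (m+[n∸m]≡n sucB≤kⁿ))

lemma6p1 : (k n : ℕ) → 2 ≤ k → 1 ≤ n →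
           (j : Fin k) (x : ℕ) → 1 ≤ x → x ≤ k ^ (n ∸ 1) →
           (a b c : ℕ) → IsSmallestLander k n a j x → IsLargestLander k n b j x →
           a ≤ c → c ≤ b →
           ∃ λ (σ : Strategy k n) → Places k n σ c j x
lemma6p1 k (suc n) _ _ j (suc B) _ sucB≤kⁿ a b c (a-lands , _) (b-lands , _) a≤c c≤b =
  landingBounds⇒canLand n j sucB≤kⁿ
    (landingBounds-between a≤c c≤b (canLand⇒landingBounds n z<s a-lands) (canLand⇒landingBounds n z<s b-lands))
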